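{- Fix $n\in\mathbb{N}$, let $e(n)=2^{2^n}$, and let $\mathcal F$ and $\mathcal C$ be as in the context. For any $\alpha\in\mathcal C$, $\alpha+s\in\langle\mathcal F\rangle$, the ideal of $\mathbb{Z}_2[\mathbb{X}]$ generated by $\mathcal F$.
   Context: $\mathbb{Z}_2$ is the field with two elements. $\mathbb{X}$ is the finite set of distinct variables $\{s,\ell,c,\bar c,b,\bar b\}\cup\bigcup_{i=0}^n(V_i\cup\bar V_i)$, where $V_i=\{s_i,f_i,q_{1i},\dots,q_{4i},c_{1i},\dots,c_{4i},b_{1i},\dots,b_{4i}\}$ and $\bar V_i=\{\bar s_i,\bar f_i,\bar q_{ki},\bar c_{ki},\bar b_{ki}: k\in\{1,2,3,4\}\}$ (barred variables are new variables). Let $\mathcal P=\bigcup_{m=0}^{n}\mathcal P_m$, where $\mathcal P_0=\{b_{i0}^2c_{i0}f_0+c_{i0}s_0 : i\in\{1,2,3,4\}\}$ and, for $1\le m\le n$, $\mathcal P_m$ consists of $q_{1m}c_{1(m-1)}s_{m-1}+s_m$; $q_{2m}c_{2(m-1)}s_{m-1}+q_{1m}b_{1(m-1)}c_{1(m-1)}f_{m-1}$; $q_{3m}c_{3(m-1)}f_{m-1}+q_{2m}c_{2(m-1)}f_{m-1}$; $q_{3m}b_{1(m-1)}c_{3(m-1)}s_{m-1}+q_{2m}b_{4(m-1)}c_{2(m-1)}s_{m-1}$; $q_{4m}b_{4(m-1)}c_{4(m-1)}f_{m-1}+q_{3m}c_{3(m-1)}s_{m-1}$; $q_{4m}c_{4(m-1)}s_{m-1}+f_m$;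 and $q_{2m}b_{3(m-1)}b_{im}c_{im}f_{m-1}+q_{2m}b_{2(m-1)}c_{im}f_{m-1}$ for $i\in\{1,2,3,4\}$. Let $\bar{\mathcal P}$ be obtained from $\mathcal P$ by replacing every variable $s_i,f_i,q_{ki},c_{ki},b_{ki}$ by $\bar s_i,\bar f_i,\bar q_{ki},\bar c_{ki},\bar b_{ki}$. Let $\mathcal G=\{b_{4n}\ell b+\ell c,\ b_{4n}\ell\bar b+\ell\bar c,\ c_{4n}f_n+\ell,\ \bar c_{4n}\bar f_n+c_{4n}s_n,\ \bar b_{4n}c_{4n}s_n+c_{4n}s_nb,\ \bar b_{4n}c_{4n}s_n+c_{4n}s_n\bar b,\ \bar c_{4n}\bar s_n+s\}$ and $\mathcal F=\mathcal P\cup\bar{\mathcal P}\cup\mathcal G$. Let $\mathcal C=\{\ell\bar c^{m_1}c^{m_2}: m_1,m_2\ge 0,\ m_1+m_2=e(n)\}$. -}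

module Defs where

open import Data.Nat using (ℕ; zero; suc; _+_) renaming (_^_ to _^ℕ_)
open import Data.Fin using (Fin; inject₁; fromℕ) renaming (zero to f0; suc to fs)
open import Data.Bool using (Bool; true; false)
open import Relation.Binary.PropositionalEquality using (_≡_)

-- Indexed variables carry a flag
-- β : Bool (false = unbarred, true = barred), a "k" index in Fin 4
-- (k = 1..4 is encoded as Fin 4 = 0..3), and a level index i ∈ {0..n}
-- encoded as Fin (suc n).

data Var (n : ℕ) : Set where
  vs vℓ vc vc̄ vb vb̄ : Var n
  sv fv : Bool → Fin (suc n) → Var n
  qv cv bv : Bool → Fin 4 → Fin (suc n) → Var n

-- Polynomial expressions over a variable type, and the congruence that
-- identifies two expressions iff they are equal in 𝔽₂[V]
-- (free commutative ring on V modulo 1 + 1 = 0).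

infixl 6 _⊕_
infixl 7 _⊗_
infix 4 _≈_

data Poly (V : Set) : Set where
  var : V → Poly V
  𝟘 𝟙 : Poly V
  _⊕_ _⊗_ : Poly V → Poly V → Poly V

data _≈_ {V : Set} : Poly V → Poly V → Set where
  refl≈  : ∀ {p} → p ≈ p
  sym≈   : ∀ {p q} → p ≈ q → q ≈ p
  trans≈ : ∀ {p q r} → p ≈ q → q ≈ r → p ≈ r
  ⊕-cong : ∀ {p p' q q'} → p ≈ p' → q ≈ q' → p ⊕ q ≈ p' ⊕ q'
  ⊗-cong : ∀ {p p' q q'} → p ≈ p' → q ≈ q' → p ⊗ q ≈ p' ⊗ q'
  ⊕-assoc : ∀ p q r → (p ⊕ q) ⊕ r ≈ p ⊕ (q ⊕ r)
  ⊕-comm  : ∀ p q → p ⊕ q ≈ q ⊕ p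
  ⊕-idˡ   : ∀ p → 𝟘 ⊕ p ≈ p
  ⊗-assoc : ∀ p q r → (p ⊗ q) ⊗ r ≈ p ⊗ (q ⊗ r)
  ⊗-comm  : ∀ p q → p ⊗ q ≈ q ⊗ p
  ⊗-idˡ   : ∀ p → 𝟙 ⊗ p ≈ p
  ⊗-zeroˡ : ∀ p → 𝟘 ⊗ p ≈ 𝟘
  distribˡ : ∀ p q r → p ⊗ (q ⊕ r) ≈ (p ⊗ q) ⊕ (p ⊗ r)
  char2   : 𝟙 ⊕ 𝟙 ≈ 𝟘

_^_ : ∀ {V} → Poly V → ℕ → Poly V
p ^ zero = 𝟙
p ^ suc k = p ⊗ (p ^ k)

data _∈⟨_⟩ {V : Set} : Poly V → (Poly V → Set) → Set₁ where
  gen  : ∀ {G p} → G p → p ∈⟨ G ⟩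
  zero∈ : ∀ {G} → 𝟘 ∈⟨ G ⟩
  add∈ : ∀ {G p q} → p ∈⟨ G ⟩ → q ∈⟨ G ⟩ → (p ⊕ q) ∈⟨ G ⟩
  mul∈ : ∀ {G p} (r : Poly V) → p ∈⟨ G ⟩ → (r ⊗ p) ∈⟨ G ⟩
  resp∈ : ∀ {G p q} → p ≈ q → p ∈⟨ G ⟩ → q ∈⟨ G ⟩

module _ {n : ℕ} where
  S F : Bool → Fin (suc n) → Poly (Var n)
  S β i = var (sv β i)
  F β i = var (fv β i)
  Q C B : Bool → Fin 4 → Fin (suc n) → Poly (Var n)
  Q β k i = var (qv β k i)
  C β k i = var (cv β k i)
  B β k i = var (bv β k i)

k1 k2 k3 k4 : Fin 4
k1 = f0
k2 = fs f0
k3 = fs (fs f0)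
k4 = fs (fs (fs f0))

-- 𝒫 (β = false) and 𝒫̄ (β = true).  For 1 ≤ m ≤ n we use j : Fin n with
-- m - 1 = inject₁ j and m = fs j.
data Pset (n : ℕ) (β : Bool) : Poly (Var n) → Set where
  p0 : (i : Fin 4) →
    Pset n β ((B β i f0 ^ 2) ⊗ C β i f0 ⊗ F β f0 ⊕ C β i f0 ⊗ S β f0)
  p1 : (j : Fin n) → let p = inject₁ j ; m = fs j in
    Pset n β (Q β k1 m ⊗ C β k1 p ⊗ S β p ⊕ S β m)
  p2 : (j : Fin n) → let p = inject₁ j ; m = fs j in
    Pset n β (Q β k2 m ⊗ C β k2 p ⊗ S β p ⊕ Q β k1 m ⊗ B β k1 p ⊗ C β k1 p ⊗ F β p)
  p3 : (j : Fin n) → let p = inject₁ j ; m = fs j in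
    Pset n β (Q β k3 m ⊗ C β k3 p ⊗ F β p ⊕ Q β k2 m ⊗ C β k2 p ⊗ F β p)
  p4 : (j : Fin n) → let p = inject₁ j ; m = fs j in
    Pset n β (Q β k3 m ⊗ B β k1 p ⊗ C β k3 p ⊗ S β p ⊕ Q β k2 m ⊗ B β k4 p ⊗ C β k2 p ⊗ S β p)
  p5 : (j : Fin n) → let p = inject₁ j ; m = fs j in
    Pset n β (Q β k4 m ⊗ B β k4 p ⊗ C β k4 p ⊗ F β p ⊕ Q β k3 m ⊗ C β k3 p ⊗ S β p)
  p6 : (j : Fin n) → let p = inject₁ j ; m = fs j in
    Pset n β (Q β k4 m ⊗ C β k4 p ⊗ S β p ⊕ F β m)
  p7 : (j : Fin n) (i : Fin 4) → let p = inject₁ j ; m = fs j in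
    Pset n β (Q β k2 m ⊗ B β k3 p ⊗ B β i m ⊗ C β i m ⊗ F β p ⊕ Q β k2 m ⊗ B β k2 p ⊗ C β i m ⊗ F β p)

module _ {n : ℕ} where
  ℓ̂ ŝ ĉ ĉ̄ b̂ b̂̄ : Poly (Var n)
  ℓ̂ = var vℓ
  ŝ = var vs
  ĉ = var vc
  ĉ̄ = var vc̄
  b̂ = var vb
  b̂̄ = var vb̄

data Gset (n : ℕ) : Poly (Var n) → Set where
  g1 : Gset n (B false k4 (fromℕ n) ⊗ ℓ̂ ⊗ b̂ ⊕ ℓ̂ ⊗ ĉ)
  g2 : Gset n (B false k4 (fromℕ n) ⊗ ℓ̂ ⊗ b̂̄ ⊕ ℓ̂ ⊗ ĉ̄)
  g3 : Gset n (C false k4 (fromℕ n) ⊗ F false (fromℕ n) ⊕ ℓ̂)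
  g4 : Gset n (C true k4 (fromℕ n) ⊗ F true (fromℕ n) ⊕ C false k4 (fromℕ n) ⊗ S false (fromℕ n))
  g5 : Gset n (B true k4 (fromℕ n) ⊗ C false k4 (fromℕ n) ⊗ S false (fromℕ n)
               ⊕ C false k4 (fromℕ n) ⊗ S false (fromℕ n) ⊗ b̂)
  g6 : Gset n (B true k4 (fromℕ n) ⊗ C false k4 (fromℕ n) ⊗ S false (fromℕ n)
               ⊕ C false k4 (fromℕ n) ⊗ S false (fromℕ n) ⊗ b̂̄)
  g7 : Gset n (C true k4 (fromℕ n) ⊗ S true (fromℕ n) ⊕ ŝ)

data Fset (n : ℕ) : Poly (Var n) → Set where
  inP  : ∀ {p} → Pset n false p → Fset n p
  inP̄  : ∀ {p} → Pset n true p → Fset n p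
  inG  : ∀ {p} → Gset n p → Fset n p

e : ℕ → ℕ
e n = 2 ^ℕ (2 ^ℕ n)

data Cset (n : ℕ) : Poly (Var n) → Set where
  mono : (m₁ m₂ : ℕ) → m₁ + m₂ ≡ e n → Cset n (ℓ̂ ⊗ (ĉ̄ ^ m₁) ⊗ (ĉ ^ m₂))

{-# OPTIONS --safe #-}
module Submission where

-- Work in 𝔽₂[𝕏]/⟨ℱ⟩. Apart from rearranging monomials, the one tool is that a relation
-- u·a = u·b can be applied repeatedly next to u: u·aᵗ = u·bᵗ.
--
-- By induction on the level i, c_{ki} s_i = c_{ki} b_{ki}^{e(i)} f_i for every k, in both the
-- unbarred and the barred copy; level 0 is 𝒫₀. For the step put ε = e(i), c = c_{k(i+1)},
-- b = b_{k(i+1)}, X₂ = c q₂ c₂ s and X₃ = c q₃ c₃ s. The k₂, k₃ relations of level i and the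
-- ε-th power of the last generator of 𝒫_{i+1} give X₂ = b^ε X₃, hence X₂ b₁ = X₂ b^ε b₄.
-- Now c s_{i+1} = X₂ b₁^{ε-1}; trading the ε-1 factors b₁ and then X₂ once more yields
-- b^{ε·ε} = b^{e(i+1)}, while the factors b₄ are absorbed into f_{i+1}.
--
-- At level n, 𝒢 turns s into c₄ s_n b̄₄^{m₁} b̄₄^{m₂}, trades these b̄₄ for b̄ and b next to
-- c₄ s_n, rewrites c₄ s_n as b₄^{e(n)} ℓ, and trades b₄b̄ and b₄b for c̄ and c next to ℓ.

open import Defs
open import Data.Bool using (Bool; true; false)
open import Data.Nat using (ℕ; zero; suc; _+_; _*_; NonZero) renaming (_^_ to _^ℕ_)
open import Data.Nat.Properties using (^-distribˡ-+-*; *-identityˡ; m^n≢0)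
open import Data.Fin using (Fin; inject₁; fromℕ; toℕ) renaming (zero to f0; suc to fs)
open import Data.Fin.Properties using (toℕ-inject₁; toℕ-fromℕ)
open import Data.Fin.Induction using (<-weakInduction)
open import Data.Product using (_,_)
open import Function using (_∘_)
open import Relation.Binary.PropositionalEquality using (_≡_; refl; cong; sym; trans; subst)
open import Relation.Binary.Bundles using (Setoid)
open import Algebra.Bundles using (CommutativeMonoid)
import Algebra.Properties.CommutativeMonoid.Mult as Powers
import Algebra.Solver.CommutativeMonoid as Solver
import Relation.Binary.Reasoning.Setoid as SetoidReasoning

module Char2 {V : Set} where

  ≈-setoid : Setoid _ _
  ≈-setoid = record
    { Carrier = Poly V ; _≈_ = _≈_
    ; isEquivalence = record { refl = refl≈ ; sym = sym≈ ; trans = trans≈ } }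

  open SetoidReasoning ≈-setoid

  ⊗-identityʳ : (p : Poly V) → p ⊗ 𝟙 ≈ p
  ⊗-identityʳ p = trans≈ (⊗-comm p 𝟙) (⊗-idˡ p)

  x⊕x≈𝟘 : (p : Poly V) → p ⊕ p ≈ 𝟘
  x⊕x≈𝟘 p = begin
    p ⊕ p              ≈⟨ ⊕-cong (⊗-identityʳ p) (⊗-identityʳ p) ⟨
    p ⊗ 𝟙 ⊕ p ⊗ 𝟙      ≈⟨ distribˡ p 𝟙 𝟙 ⟨
    p ⊗ (𝟙 ⊕ 𝟙)        ≈⟨ ⊗-cong refl≈ char2 ⟩
    p ⊗ 𝟘              ≈⟨ ⊗-comm p 𝟘 ⟩
    𝟘 ⊗ p              ≈⟨ ⊗-zeroˡ p ⟩
    𝟘                  ∎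

  ⊕-telescope : (p q r : Poly V) → (p ⊕ q) ⊕ (q ⊕ r) ≈ p ⊕ r
  ⊕-telescope p q r = begin
    (p ⊕ q) ⊕ (q ⊕ r)  ≈⟨ ⊕-assoc p q (q ⊕ r) ⟩
    p ⊕ (q ⊕ (q ⊕ r))  ≈⟨ ⊕-cong refl≈ (⊕-assoc q q r) ⟨
    p ⊕ ((q ⊕ q) ⊕ r)  ≈⟨ ⊕-cong refl≈ (⊕-cong (x⊕x≈𝟘 q) refl≈) ⟩
    p ⊕ (𝟘 ⊕ r)        ≈⟨ ⊕-cong refl≈ (⊕-idˡ r) ⟩
    p ⊕ r              ∎

module Quotient {V : Set} (G : Poly V → Set) where
  open Char2 {V}

  infix 4 _~_
  _~_ : Poly V → Poly V → Set₁
  p ~ q = (p ⊕ q) ∈⟨ G ⟩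

  ≈⇒~ : ∀ {p q} → p ≈ q → p ~ q
  ≈⇒~ {p} p≈q = resp∈ (trans≈ (sym≈ (x⊕x≈𝟘 p)) (⊕-cong refl≈ p≈q)) zero∈

  ~-sym : ∀ {p q} → p ~ q → q ~ p
  ~-sym {p} {q} = resp∈ (⊕-comm p q)

  ~-trans : ∀ {p q r} → p ~ q → q ~ r → p ~ r
  ~-trans {p} {q} {r} p~q q~r = resp∈ (⊕-telescope p q r) (add∈ p~q q~r)

  ⊗-congˡ : ∀ r {p q} → p ~ q → r ⊗ p ~ r ⊗ q
  ⊗-congˡ r {p} {q} p~q = resp∈ (distribˡ r p q) (mul∈ r p~q)

  ⊗-cong~ : ∀ {p p′ q q′} → p ~ p′ → q ~ q′ → p ⊗ q ~ p′ ⊗ q′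
  ⊗-cong~ {p} {p′} {q} {q′} p~p′ q~q′ =
    ~-trans (⊗-congˡ p q~q′)
      (~-trans (≈⇒~ (⊗-comm p q′)) (~-trans (⊗-congˡ q′ p~p′) (≈⇒~ (⊗-comm q′ p′))))

  *-commutativeMonoid : CommutativeMonoid _ _
  *-commutativeMonoid = record
    { Carrier = Poly V ; _≈_ = _~_ ; _∙_ = _⊗_ ; ε = 𝟙
    ; isCommutativeMonoid = record
      { isMonoid = record
        { isSemigroup = record
          { isMagma = record
            { isEquivalence = record { refl = ≈⇒~ refl≈ ; sym = ~-sym ; trans = ~-trans }
            ; ∙-cong = ⊗-cong~ }
          ; assoc = λ p q r → ≈⇒~ (⊗-assoc p q r) }
        ; identity = (λ p → ≈⇒~ (⊗-idˡ p)) , (λ p → ≈⇒~ (⊗-identityʳ p)) }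
      ; comm = λ p q → ≈⇒~ (⊗-comm p q) } }

  open CommutativeMonoid *-commutativeMonoid public using (setoid) renaming (refl to ~-refl)
  open SetoidReasoning setoid public
  open Solver *-commutativeMonoid public using (solve; _⊜_) renaming (_⊕_ to infixl 7 _·_)
  open Powers *-commutativeMonoid using (_×_; ×-homo-+; ×-distrib-+; ×-assocˡ)

  -- The library writes the t-th power in a monoid additively, as t × x.
  ^≡× : ∀ x t → x ^ t ≡ t × x
  ^≡× x zero = refl
  ^≡× x (suc t) = cong (x ⊗_) (^≡× x t)

  ⊗-congʳ : ∀ r {p q} → p ~ q → p ⊗ r ~ q ⊗ r
  ⊗-congʳ r p~q = ⊗-cong~ p~q ~-refl

  ^-homo-+ : ∀ x m n → x ^ (m + n) ~ x ^ m ⊗ x ^ n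
  ^-homo-+ x m n rewrite ^≡× x (m + n) | ^≡× x m | ^≡× x n = ×-homo-+ x m n

  ^-distrib-⊗ : ∀ x y t → (x ⊗ y) ^ t ~ x ^ t ⊗ y ^ t
  ^-distrib-⊗ x y t rewrite ^≡× (x ⊗ y) t | ^≡× x t | ^≡× y t = ×-distrib-+ x y t

  ^-assoc : ∀ x m n → (x ^ n) ^ m ~ x ^ (m * n)
  ^-assoc x m n rewrite ^≡× (x ^ n) m | ^≡× x n | ^≡× x (m * n) = ×-assocˡ x m n

  ^-transfer : ∀ {u a b} → u ⊗ a ~ u ⊗ b → ∀ t → u ⊗ a ^ t ~ u ⊗ b ^ t
  ^-transfer ua~ub zero = ~-refl
  ^-transfer {u} {a} {b} ua~ub (suc t) = begin
    u ⊗ (a ⊗ a ^ t)  ≈⟨ solve 3 (λ u a aᵗ → u · (a · aᵗ) ⊜ aᵗ · (u · a)) ~-refl u a (a ^ t) ⟩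
    a ^ t ⊗ (u ⊗ a)  ≈⟨ ⊗-congˡ (a ^ t) ua~ub ⟩
    a ^ t ⊗ (u ⊗ b)  ≈⟨ solve 3 (λ u b aᵗ → aᵗ · (u · b) ⊜ b · (u · aᵗ)) ~-refl u b (a ^ t) ⟩
    b ⊗ (u ⊗ a ^ t)  ≈⟨ ⊗-congˡ b (^-transfer ua~ub t) ⟩
    b ⊗ (u ⊗ b ^ t)  ≈⟨ solve 3 (λ u b bᵗ → b · (u · bᵗ) ⊜ u · (b · bᵗ)) ~-refl u b (b ^ t) ⟩
    u ⊗ (b ⊗ b ^ t)  ∎

  ^-transfer₂ : ∀ {u a b a′ b′} → u ⊗ a ~ u ⊗ b → u ⊗ a′ ~ u ⊗ b′ →
                ∀ m m′ → u ⊗ a ^ m ⊗ a′ ^ m′ ~ u ⊗ b ^ m ⊗ b′ ^ m′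
  ^-transfer₂ {u} {a} {b} {a′} {b′} ua~ub ua′~ub′ m m′ = begin
    u ⊗ a ^ m ⊗ a′ ^ m′    ≈⟨ ⊗-congʳ (a′ ^ m′) (^-transfer ua~ub m) ⟩
    u ⊗ b ^ m ⊗ a′ ^ m′    ≈⟨ solve 3 (λ u x y → u · x · y ⊜ x · (u · y)) ~-refl u (b ^ m) (a′ ^ m′) ⟩
    b ^ m ⊗ (u ⊗ a′ ^ m′)  ≈⟨ ⊗-congˡ (b ^ m) (^-transfer ua′~ub′ m′) ⟩
    b ^ m ⊗ (u ⊗ b′ ^ m′)  ≈⟨ solve 3 (λ u x y → x · (u · y) ⊜ u · x · y) ~-refl u (b ^ m) (b′ ^ m′) ⟩
    u ⊗ b ^ m ⊗ b′ ^ m′    ∎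

module Levels (n : ℕ) where
  open Quotient (Fset n)

  𝒫 : ∀ β {x} → Pset n β x → x ∈⟨ Fset n ⟩
  𝒫 false = gen ∘ inP
  𝒫 true = gen ∘ inP̄

  LevelRelation : Bool → ℕ → Fin (suc n) → Set₁
  LevelRelation β ε i = ∀ k → C β k i ⊗ S β i ~ C β k i ⊗ B β k i ^ ε ⊗ F β i

  level-zero : ∀ β → LevelRelation β 2 f0
  level-zero β k = begin
    C β k f0 ⊗ S β f0                 ≈⟨ 𝒫 β (p0 k) ⟨
    B β k f0 ^ 2 ⊗ C β k f0 ⊗ F β f0  ≈⟨ solve 3 (λ b² c f → b² · c · f ⊜ c · b² · f) ~-refl _ _ _ ⟩
    C β k f0 ⊗ B β k f0 ^ 2 ⊗ F β f0  ∎

  module LevelStep (β : Bool) (j : Fin n) (ε′ : ℕ) (IH : LevelRelation β (suc ε′) (inject₁ j)) (i : Fin 4) where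
    ε : ℕ
    ε = suc ε′

    s f s′ f′ cᵢ bᵢ : Poly (Var n)
    s = S β (inject₁ j)
    f = F β (inject₁ j)
    s′ = S β (fs j)
    f′ = F β (fs j)
    cᵢ = C β i (fs j)
    bᵢ = B β i (fs j)

    c b q : Fin 4 → Poly (Var n)
    c k = C β k (inject₁ j)
    b k = B β k (inject₁ j)
    q k = Q β k (fs j)

    X₂ X₃ : Poly (Var n)
    X₂ = cᵢ ⊗ (q k2 ⊗ c k2 ⊗ s)
    X₃ = cᵢ ⊗ (q k3 ⊗ c k3 ⊗ s)

    X₂~bᵉX₃ : X₂ ~ bᵢ ^ ε ⊗ X₃
    X₂~bᵉX₃ = begin
      cᵢ ⊗ (q k2 ⊗ c k2 ⊗ s)
        ≈⟨ solve 4 (λ cᵢ q c s → cᵢ · (q · c · s) ⊜ cᵢ · q · (c · s)) ~-refl cᵢ (q k2) (c k2) s ⟩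
      cᵢ ⊗ q k2 ⊗ (c k2 ⊗ s)
        ≈⟨ ⊗-congˡ _ (IH k2) ⟩
      cᵢ ⊗ q k2 ⊗ (c k2 ⊗ b k2 ^ ε ⊗ f)
        ≈⟨ solve 5 (λ cᵢ q c bᵉ f → cᵢ · q · (c · bᵉ · f) ⊜ c · (q · cᵢ · f · bᵉ)) ~-refl
             cᵢ (q k2) (c k2) (b k2 ^ ε) f ⟩
      c k2 ⊗ (q k2 ⊗ cᵢ ⊗ f ⊗ b k2 ^ ε)
        ≈⟨ ⊗-congˡ _ (^-transfer p₇ ε) ⟩
      c k2 ⊗ (q k2 ⊗ cᵢ ⊗ f ⊗ (b k3 ⊗ bᵢ) ^ ε)
        ≈⟨ ⊗-congˡ _ (⊗-congˡ _ (^-distrib-⊗ (b k3) bᵢ ε)) ⟩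
      c k2 ⊗ (q k2 ⊗ cᵢ ⊗ f ⊗ (b k3 ^ ε ⊗ bᵢ ^ ε))
        ≈⟨ solve 6 (λ c q cᵢ f b₃ᵉ bᵢᵉ → c · (q · cᵢ · f · (b₃ᵉ · bᵢᵉ)) ⊜ cᵢ · b₃ᵉ · bᵢᵉ · (q · c · f)) ~-refl
             (c k2) (q k2) cᵢ f (b k3 ^ ε) (bᵢ ^ ε) ⟩
      cᵢ ⊗ b k3 ^ ε ⊗ bᵢ ^ ε ⊗ (q k2 ⊗ c k2 ⊗ f)
        ≈⟨ ⊗-congˡ _ (𝒫 β (p3 j)) ⟨
      cᵢ ⊗ b k3 ^ ε ⊗ bᵢ ^ ε ⊗ (q k3 ⊗ c k3 ⊗ f)
        ≈⟨ solve 6 (λ cᵢ b₃ᵉ bᵢᵉ q c f → cᵢ · b₃ᵉ · bᵢᵉ · (q · c · f) ⊜ bᵢᵉ · cᵢ · q · (c · b₃ᵉ · f)) ~-refl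
             cᵢ (b k3 ^ ε) (bᵢ ^ ε) (q k3) (c k3) f ⟩
      bᵢ ^ ε ⊗ cᵢ ⊗ q k3 ⊗ (c k3 ⊗ b k3 ^ ε ⊗ f)
        ≈⟨ ⊗-congˡ _ (IH k3) ⟨
      bᵢ ^ ε ⊗ cᵢ ⊗ q k3 ⊗ (c k3 ⊗ s)
        ≈⟨ solve 5 (λ bᵢᵉ cᵢ q c s → bᵢᵉ · cᵢ · q · (c · s) ⊜ bᵢᵉ · (cᵢ · (q · c · s))) ~-refl
             (bᵢ ^ ε) cᵢ (q k3) (c k3) s ⟩
      bᵢ ^ ε ⊗ X₃ ∎
      where
      p₇ : q k2 ⊗ cᵢ ⊗ f ⊗ b k2 ~ q k2 ⊗ cᵢ ⊗ f ⊗ (b k3 ⊗ bᵢ)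
      p₇ = begin
        q k2 ⊗ cᵢ ⊗ f ⊗ b k2
          ≈⟨ solve 4 (λ q cᵢ f b → q · cᵢ · f · b ⊜ q · b · cᵢ · f) ~-refl (q k2) cᵢ f (b k2) ⟩
        q k2 ⊗ b k2 ⊗ cᵢ ⊗ f
          ≈⟨ 𝒫 β (p7 j i) ⟨
        q k2 ⊗ b k3 ⊗ bᵢ ⊗ cᵢ ⊗ f
          ≈⟨ solve 5 (λ q b bᵢ cᵢ f → q · b · bᵢ · cᵢ · f ⊜ q · cᵢ · f · (b · bᵢ)) ~-refl (q k2) (b k3) bᵢ cᵢ f ⟩
        q k2 ⊗ cᵢ ⊗ f ⊗ (b k3 ⊗ bᵢ) ∎

    X₂b₁~X₂bᵉb₄ : X₂ ⊗ b k1 ~ X₂ ⊗ (bᵢ ^ ε ⊗ b k4)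
    X₂b₁~X₂bᵉb₄ = begin
      X₂ ⊗ b k1
        ≈⟨ ⊗-congʳ (b k1) X₂~bᵉX₃ ⟩
      bᵢ ^ ε ⊗ (cᵢ ⊗ (q k3 ⊗ c k3 ⊗ s)) ⊗ b k1
        ≈⟨ solve 6 (λ bᵢᵉ cᵢ q c s b → bᵢᵉ · (cᵢ · (q · c · s)) · b ⊜ bᵢᵉ · cᵢ · (q · b · c · s)) ~-refl
             (bᵢ ^ ε) cᵢ (q k3) (c k3) s (b k1) ⟩
      bᵢ ^ ε ⊗ cᵢ ⊗ (q k3 ⊗ b k1 ⊗ c k3 ⊗ s)
        ≈⟨ ⊗-congˡ _ (𝒫 β (p4 j)) ⟩
      bᵢ ^ ε ⊗ cᵢ ⊗ (q k2 ⊗ b k4 ⊗ c k2 ⊗ s)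
        ≈⟨ solve 6 (λ bᵢᵉ cᵢ q b c s → bᵢᵉ · cᵢ · (q · b · c · s) ⊜ cᵢ · (q · c · s) · (bᵢᵉ · b)) ~-refl
             (bᵢ ^ ε) cᵢ (q k2) (b k4) (c k2) s ⟩
      X₂ ⊗ (bᵢ ^ ε ⊗ b k4) ∎

    cs′~X₂bᵉ⁻¹ : cᵢ ⊗ s′ ~ X₂ ⊗ b k1 ^ ε′
    cs′~X₂bᵉ⁻¹ = begin
      cᵢ ⊗ s′
        ≈⟨ ⊗-congˡ cᵢ (𝒫 β (p1 j)) ⟨
      cᵢ ⊗ (q k1 ⊗ c k1 ⊗ s)
        ≈⟨ solve 4 (λ cᵢ q c s → cᵢ · (q · c · s) ⊜ cᵢ · q · (c · s)) ~-refl cᵢ (q k1) (c k1) s ⟩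
      cᵢ ⊗ q k1 ⊗ (c k1 ⊗ s)
        ≈⟨ ⊗-congˡ _ (IH k1) ⟩
      cᵢ ⊗ q k1 ⊗ (c k1 ⊗ (b k1 ⊗ b k1 ^ ε′) ⊗ f)
        ≈⟨ solve 6 (λ cᵢ q c b bᵉ⁻¹ f → cᵢ · q · (c · (b · bᵉ⁻¹) · f) ⊜ cᵢ · bᵉ⁻¹ · (q · b · c · f)) ~-refl
             cᵢ (q k1) (c k1) (b k1) (b k1 ^ ε′) f ⟩
      cᵢ ⊗ b k1 ^ ε′ ⊗ (q k1 ⊗ b k1 ⊗ c k1 ⊗ f)
        ≈⟨ ⊗-congˡ _ (𝒫 β (p2 j)) ⟨
      cᵢ ⊗ b k1 ^ ε′ ⊗ (q k2 ⊗ c k2 ⊗ s)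
        ≈⟨ solve 5 (λ cᵢ bᵉ⁻¹ q c s → cᵢ · bᵉ⁻¹ · (q · c · s) ⊜ cᵢ · (q · c · s) · bᵉ⁻¹) ~-refl
             cᵢ (b k1 ^ ε′) (q k2) (c k2) s ⟩
      X₂ ⊗ b k1 ^ ε′ ∎

    bᵉ⁻¹X₃~cf′ : b k4 ^ ε′ ⊗ X₃ ~ cᵢ ⊗ f′
    bᵉ⁻¹X₃~cf′ = begin
      b k4 ^ ε′ ⊗ (cᵢ ⊗ (q k3 ⊗ c k3 ⊗ s))
        ≈⟨ solve 5 (λ bᵉ⁻¹ cᵢ q c s → bᵉ⁻¹ · (cᵢ · (q · c · s)) ⊜ bᵉ⁻¹ · cᵢ · (q · c · s)) ~-refl
             (b k4 ^ ε′) cᵢ (q k3) (c k3) s ⟩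
      b k4 ^ ε′ ⊗ cᵢ ⊗ (q k3 ⊗ c k3 ⊗ s)
        ≈⟨ ⊗-congˡ _ (𝒫 β (p5 j)) ⟨
      b k4 ^ ε′ ⊗ cᵢ ⊗ (q k4 ⊗ b k4 ⊗ c k4 ⊗ f)
        ≈⟨ solve 6 (λ bᵉ⁻¹ cᵢ q b c f → bᵉ⁻¹ · cᵢ · (q · b · c · f) ⊜ cᵢ · q · (c · (b · bᵉ⁻¹) · f)) ~-refl
             (b k4 ^ ε′) cᵢ (q k4) (b k4) (c k4) f ⟩
      cᵢ ⊗ q k4 ⊗ (c k4 ⊗ (b k4 ⊗ b k4 ^ ε′) ⊗ f)
        ≈⟨ ⊗-congˡ _ (IH k4) ⟨
      cᵢ ⊗ q k4 ⊗ (c k4 ⊗ s)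
        ≈⟨ solve 4 (λ cᵢ q c s → cᵢ · q · (c · s) ⊜ cᵢ · (q · c · s)) ~-refl cᵢ (q k4) (c k4) s ⟩
      cᵢ ⊗ (q k4 ⊗ c k4 ⊗ s)
        ≈⟨ ⊗-congˡ cᵢ (𝒫 β (p6 j)) ⟩
      cᵢ ⊗ f′ ∎

    cs′~cbᵉᵉf′ : cᵢ ⊗ s′ ~ cᵢ ⊗ bᵢ ^ (ε * ε) ⊗ f′
    cs′~cbᵉᵉf′ = begin
      cᵢ ⊗ s′
        ≈⟨ cs′~X₂bᵉ⁻¹ ⟩
      X₂ ⊗ b k1 ^ ε′
        ≈⟨ ^-transfer X₂b₁~X₂bᵉb₄ ε′ ⟩
      X₂ ⊗ (bᵢ ^ ε ⊗ b k4) ^ ε′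
        ≈⟨ ⊗-cong~ X₂~bᵉX₃ (^-distrib-⊗ (bᵢ ^ ε) (b k4) ε′) ⟩
      bᵢ ^ ε ⊗ X₃ ⊗ ((bᵢ ^ ε) ^ ε′ ⊗ b k4 ^ ε′)
        ≈⟨ solve 4 (λ x X b y → x · X · (b · y) ⊜ x · b · (y · X)) ~-refl (bᵢ ^ ε) X₃ ((bᵢ ^ ε) ^ ε′) (b k4 ^ ε′) ⟩
      (bᵢ ^ ε) ^ ε ⊗ (b k4 ^ ε′ ⊗ X₃)
        ≈⟨ ⊗-cong~ (^-assoc bᵢ ε ε) bᵉ⁻¹X₃~cf′ ⟩
      bᵢ ^ (ε * ε) ⊗ (cᵢ ⊗ f′)
        ≈⟨ solve 3 (λ x cᵢ f′ → x · (cᵢ · f′) ⊜ cᵢ · x · f′) ~-refl (bᵢ ^ (ε * ε)) cᵢ f′ ⟩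
      cᵢ ⊗ bᵢ ^ (ε * ε) ⊗ f′ ∎

  level-step : ∀ β j {ε} .{{_ : NonZero ε}} → LevelRelation β ε (inject₁ j) → LevelRelation β (ε * ε) (fs j)
  level-step β j {suc ε′} IH i = LevelStep.cs′~cbᵉᵉf′ β j ε′ IH i

  e-suc : ∀ k → e (suc k) ≡ e k * e k
  e-suc k = trans (^-distribˡ-+-* 2 (2 ^ℕ k) (1 * 2 ^ℕ k)) (cong (λ x → e k * 2 ^ℕ x) (*-identityˡ (2 ^ℕ k)))

  level-relation : ∀ β (i : Fin (suc n)) → LevelRelation β (e (toℕ i)) i
  level-relation β = <-weakInduction (λ i → LevelRelation β (e (toℕ i)) i) (level-zero β) step
    where
    step : ∀ j → LevelRelation β (e (toℕ (inject₁ j))) (inject₁ j) → LevelRelation β (e (toℕ (fs j))) (fs j)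
    step j R rewrite toℕ-inject₁ j | e-suc (toℕ j) = level-step β j {{m^n≢0 2 (2 ^ℕ toℕ j)}} R

module TopLevel (n m₁ m₂ : ℕ) (m₁+m₂≡eₙ : m₁ + m₂ ≡ e n) where
  open Quotient (Fset n)
  open Levels n

  𝒢 : ∀ {x} → Gset n x → x ∈⟨ Fset n ⟩
  𝒢 = gen ∘ inG

  c₄ b₄ s f c̄₄ b̄₄ s̄ f̄ : Poly (Var n)
  c₄ = C false k4 (fromℕ n)
  b₄ = B false k4 (fromℕ n)
  s = S false (fromℕ n)
  f = F false (fromℕ n)
  c̄₄ = C true k4 (fromℕ n)
  b̄₄ = B true k4 (fromℕ n)
  s̄ = S true (fromℕ n)
  f̄ = F true (fromℕ n)

  top-relation : ∀ β → LevelRelation β (m₁ + m₂) (fromℕ n)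
  top-relation β = subst (λ ε → LevelRelation β ε (fromℕ n))
                         (trans (cong e (toℕ-fromℕ n)) (sym m₁+m₂≡eₙ)) (level-relation β (fromℕ n))

  ŝ~cs : ŝ ~ c₄ ⊗ s ⊗ b̄₄ ^ m₁ ⊗ b̄₄ ^ m₂
  ŝ~cs = begin
    ŝ                                ≈⟨ 𝒢 g7 ⟨
    c̄₄ ⊗ s̄                           ≈⟨ top-relation true k4 ⟩
    c̄₄ ⊗ b̄₄ ^ (m₁ + m₂) ⊗ f̄          ≈⟨ ⊗-congʳ f̄ (⊗-congˡ c̄₄ (^-homo-+ b̄₄ m₁ m₂)) ⟩
    c̄₄ ⊗ (b̄₄ ^ m₁ ⊗ b̄₄ ^ m₂) ⊗ f̄     ≈⟨ solve 4 (λ c x y f → c · (x · y) · f ⊜ x · y · (c · f)) ~-refl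
                                           c̄₄ (b̄₄ ^ m₁) (b̄₄ ^ m₂) f̄ ⟩
    b̄₄ ^ m₁ ⊗ b̄₄ ^ m₂ ⊗ (c̄₄ ⊗ f̄)     ≈⟨ ⊗-congˡ _ (𝒢 g4) ⟩
    b̄₄ ^ m₁ ⊗ b̄₄ ^ m₂ ⊗ (c₄ ⊗ s)     ≈⟨ solve 4 (λ x y c s → x · y · (c · s) ⊜ c · s · x · y) ~-refl
                                           (b̄₄ ^ m₁) (b̄₄ ^ m₂) c₄ s ⟩
    c₄ ⊗ s ⊗ b̄₄ ^ m₁ ⊗ b̄₄ ^ m₂       ∎

  cs-transfer : c₄ ⊗ s ⊗ b̄₄ ^ m₁ ⊗ b̄₄ ^ m₂ ~ c₄ ⊗ s ⊗ b̂̄ ^ m₁ ⊗ b̂ ^ m₂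
  cs-transfer = ^-transfer₂ (~-trans csb̄₄~b̄₄cs (𝒢 g6)) (~-trans csb̄₄~b̄₄cs (𝒢 g5)) m₁ m₂
    where
    csb̄₄~b̄₄cs : c₄ ⊗ s ⊗ b̄₄ ~ b̄₄ ⊗ c₄ ⊗ s
    csb̄₄~b̄₄cs = solve 3 (λ c s b → c · s · b ⊜ b · c · s) ~-refl c₄ s b̄₄

  cs~ℓ : c₄ ⊗ s ⊗ b̂̄ ^ m₁ ⊗ b̂ ^ m₂ ~ ℓ̂ ⊗ (b₄ ⊗ b̂̄) ^ m₁ ⊗ (b₄ ⊗ b̂) ^ m₂
  cs~ℓ = begin
    c₄ ⊗ s ⊗ b̂̄ ^ m₁ ⊗ b̂ ^ m₂
      ≈⟨ ⊗-congʳ _ (⊗-congʳ _ (top-relation false k4)) ⟩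
    c₄ ⊗ b₄ ^ (m₁ + m₂) ⊗ f ⊗ b̂̄ ^ m₁ ⊗ b̂ ^ m₂
      ≈⟨ ⊗-congʳ _ (⊗-congʳ _ (⊗-congʳ f (⊗-congˡ c₄ (^-homo-+ b₄ m₁ m₂)))) ⟩
    c₄ ⊗ (b₄ ^ m₁ ⊗ b₄ ^ m₂) ⊗ f ⊗ b̂̄ ^ m₁ ⊗ b̂ ^ m₂
      ≈⟨ solve 6 (λ c x y f x′ y′ → c · (x · y) · f · x′ · y′ ⊜ x · x′ · (y · y′) · (c · f)) ~-refl
           c₄ (b₄ ^ m₁) (b₄ ^ m₂) f (b̂̄ ^ m₁) (b̂ ^ m₂) ⟩
    b₄ ^ m₁ ⊗ b̂̄ ^ m₁ ⊗ (b₄ ^ m₂ ⊗ b̂ ^ m₂) ⊗ (c₄ ⊗ f)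
      ≈⟨ ⊗-congˡ _ (𝒢 g3) ⟩
    b₄ ^ m₁ ⊗ b̂̄ ^ m₁ ⊗ (b₄ ^ m₂ ⊗ b̂ ^ m₂) ⊗ ℓ̂
      ≈⟨ ⊗-congʳ ℓ̂ (⊗-cong~ (^-distrib-⊗ b₄ b̂̄ m₁) (^-distrib-⊗ b₄ b̂ m₂)) ⟨
    (b₄ ⊗ b̂̄) ^ m₁ ⊗ (b₄ ⊗ b̂) ^ m₂ ⊗ ℓ̂
      ≈⟨ solve 3 (λ x y ℓ → x · y · ℓ ⊜ ℓ · x · y) ~-refl ((b₄ ⊗ b̂̄) ^ m₁) ((b₄ ⊗ b̂) ^ m₂) ℓ̂ ⟩
    ℓ̂ ⊗ (b₄ ⊗ b̂̄) ^ m₁ ⊗ (b₄ ⊗ b̂) ^ m₂ ∎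

  ℓ-transfer : ℓ̂ ⊗ (b₄ ⊗ b̂̄) ^ m₁ ⊗ (b₄ ⊗ b̂) ^ m₂ ~ ℓ̂ ⊗ ĉ̄ ^ m₁ ⊗ ĉ ^ m₂
  ℓ-transfer = ^-transfer₂ (~-trans (ℓb₄x~b₄ℓx b̂̄) (𝒢 g2)) (~-trans (ℓb₄x~b₄ℓx b̂) (𝒢 g1)) m₁ m₂
    where
    ℓb₄x~b₄ℓx : ∀ x → ℓ̂ ⊗ (b₄ ⊗ x) ~ b₄ ⊗ ℓ̂ ⊗ x
    ℓb₄x~b₄ℓx = solve 3 (λ ℓ b x → ℓ · (b · x) ⊜ b · ℓ · x) ~-refl ℓ̂ b₄

proposition4p3 : (n : ℕ) (α : Poly (Var n)) → Cset n α → (α ⊕ ŝ) ∈⟨ Fset n ⟩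
proposition4p3 n _ (mono m₁ m₂ m₁+m₂≡eₙ) = begin
  ℓ̂ ⊗ ĉ̄ ^ m₁ ⊗ ĉ ^ m₂                ≈⟨ ℓ-transfer ⟨
  ℓ̂ ⊗ (b₄ ⊗ b̂̄) ^ m₁ ⊗ (b₄ ⊗ b̂) ^ m₂  ≈⟨ cs~ℓ ⟨
  c₄ ⊗ s ⊗ b̂̄ ^ m₁ ⊗ b̂ ^ m₂           ≈⟨ cs-transfer ⟨
  c₄ ⊗ s ⊗ b̄₄ ^ m₁ ⊗ b̄₄ ^ m₂          ≈⟨ ŝ~cs ⟨
  ŝ                                  ∎
  where
  open Quotient (Fset n)
  open TopLevel n m₁ m₂ m₁+m₂≡eₙ
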